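{- Let $k\geq 2$ be an integer, let $H$ be a graph and $\mathcal{C}_H$ a collection of pairwise disjoint non-empty subsets of $V(H)$ such that for each $D\in\mathcal{C}_H$ we have $\overline{e}_H(D)\leq (k-1)|D|+1$ and $\deg_H(v)\geq k$ for all $v\in D$. If $V_{\leq k-1}(H)=\{w\}$ and $\operatorname{sh}_H(w)\neq V(H)$, then $H-\operatorname{sh}_H(w)$ is a non-empty graph with minimum degree at least $k$.
   Context: Graphs are finite and simple. $V_{\leq k-1}(H)$ is the set of vertices of $H$ of degree at most $k-1$. For $X\subseteq V(H)$, $\overline{e}_H(X)$ is the number of edges of $H$ incident with at least one vertex of $X$, and $H-X$ is the graph obtained by deleting $X$. A vertex $v$ is adjacent to a set $X$ if it is adjacent to some vertex of $X$. For $w\in V_{\leq k-1}(H)$, the shadow $\operatorname{sh}_H(w)$ (with respect to $\mathcal{C}_H$) is the unique minimal (under inclusion) set $Y\subseteq V(H)$ such that: (I) $w\in Y$; (II) for each $D\in\mathcal{C}_H$, either $D\subseteq Y$ or $D\cap Y=\emptyset$; (III) if $v\in V(H)\setminus Y$ is adjacent to a vertex in $Y$, then $\deg_{H-Y}(v)\geq k$; (IV) if $D\in\mathcal{C}_H$ is adjacent to a vertex in $Y$, then $D\subseteq Y$. -}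

module Defs where

open import Data.Nat using (ℕ; _≤_; _<_; _<ᵇ_)
open import Data.Bool using (Bool; true; false; _∧_; _∨_)
open import Data.Fin using (Fin; toℕ)
open import Data.Vec using (tabulate; lookup)
open import Data.Vec using () renaming (sum to vsum)
open import Data.Fin.Subset using (Subset; _∈_; _∉_; _⊆_; _∩_; ∁; ∣_∣; Empty; Nonempty)
open import Data.List using (List)
open import Data.List.Membership.Propositional using () renaming (_∈_ to _∈L_)
open import Data.List.Relation.Unary.AllPairs using (AllPairs)
open import Data.Product using (Σ; _×_; ∃)
open import Data.Sum using (_⊎_)
open import Relation.Binary.PropositionalEquality using (_≡_)

record Graph (n : ℕ) : Set where
  field
    adj    : Fin n → Fin n → Bool
    sym    : ∀ u v → adj u v ≡ adj v u
    irrefl : ∀ v → adj v v ≡ false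
open Graph public

module _ {n : ℕ} (H : Graph n) where

  nbr : Fin n → Subset n
  nbr v = tabulate (adj H v)

  deg : Fin n → ℕ
  deg v = ∣ nbr v ∣

  -- deg_{H - Y}(v)  (meaningful for v ∉ Y): neighbours of v outside Y
  degMinus : Subset n → Fin n → ℕ
  degMinus Y v = ∣ nbr v ∩ ∁ Y ∣

  -- ē_H(X): number of edges uv (counted once, toℕ u < toℕ v) with u ∈ X or v ∈ X
  edgesIncident : Subset n → ℕ
  edgesIncident X =
    vsum (tabulate λ u → ∣ tabulate (λ v →
      (toℕ u <ᵇ toℕ v) ∧ (adj H u v ∧ (lookup X u ∨ lookup X v))) ∣)

  AdjToSet : Fin n → Subset n → Set
  AdjToSet v X = ∃ λ u → u ∈ X × adj H v u ≡ true

  SetAdjToSet : Subset n → Subset n → Set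
  SetAdjToSet D X = ∃ λ d → d ∈ D × AdjToSet d X

  -- conditions (I)-(IV) defining shadow candidates for w, w.r.t. collection C and k
  ShadowConditions : ℕ → List (Subset n) → Fin n → Subset n → Set
  ShadowConditions k C w Y =
    (w ∈ Y)
    × (∀ D → D ∈L C → D ⊆ Y ⊎ Empty (D ∩ Y))
    × (∀ v → v ∉ Y → AdjToSet v Y → k ≤ degMinus Y v)
    × (∀ D → D ∈L C → SetAdjToSet D Y → D ⊆ Y)

  -- Y is sh_H(w): the unique minimal (= least, as the family is finite) set satisfying (I)-(IV)
  IsShadow : ℕ → List (Subset n) → Fin n → Subset n → Set
  IsShadow k C w Y =
    ShadowConditions k C w Y × (∀ Z → ShadowConditions k C w Z → Y ⊆ Z)

  GoodCollection : ℕ → List (Subset n) → Set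
  GoodCollection k C =
    AllPairs (λ D D′ → Empty (D ∩ D′)) C
    × (∀ D → D ∈L C → Nonempty D)
    × (∀ D → D ∈L C → edgesIncident D Data.Nat.≤ (k Data.Nat.∸ 1) Data.Nat.* ∣ D ∣ Data.Nat.+ 1)
    × (∀ D → D ∈L C → ∀ v → v ∈ D → k ≤ deg v)

  LowSetIs : ℕ → Fin n → Set
  LowSetIs k w = ∀ v → (deg v ≤ k Data.Nat.∸ 1 → v ≡ w) × (v ≡ w → deg v ≤ k Data.Nat.∸ 1)

module Submission where

-- Only two properties of the shadow are used: w ∈ Y (condition (I)) and
-- condition (III).  For the
-- degree bound take v ∉ Y and split on whether v has a neighbour in Y:
--   * if it does, condition (III) gives deg_{H-Y}(v) ≥ k directly;
--   * if it does not, every neighbour of v survives in H - Y, so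
--     deg_{H-Y}(v) = deg_H(v); and v ≠ w (as w ∈ Y), so v is not in
--     V_{≤k-1}(H) = {w}, i.e. deg_H(v) ≥ k.

open import Defs
open import Data.Nat using (ℕ; suc; _≤_; _≤?_)
open import Data.Nat.Properties using (≰⇒>; ≤-trans)
open import Data.Fin using (Fin)
open import Data.Fin.Properties using (any?)
open import Data.Fin.Subset using (Subset; ⊤; _∈_; _∉_; _⊆_; _∩_; ∁)
open import Data.Fin.Subset.Properties
  using (_∈?_; ⊆-antisym; ⊆⊤; x∉p⇒x∈∁p; x∈p∩q⁺; p⊆q⇒∣p∣≤∣q∣)
open import Data.Vec.Properties using ([]=⇒lookup; lookup∘tabulate)
open import Data.Bool using (true) renaming (_≟_ to _≟ᵇ_)
open import Data.List using (List)
open import Data.Product using (_×_; ∃; _,_; proj₁)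
open import Relation.Nullary using (¬_; yes; no)
open import Relation.Nullary.Decidable using (_×-dec_; ¬?)
open import Relation.Binary.PropositionalEquality using (_≡_; trans; subst) renaming (sym to ≡-sym)
open import Data.Empty using (⊥-elim)

missing-element : ∀ {n} (Y : Subset n) → ¬ (Y ≡ ⊤) → ∃ λ v → v ∉ Y
missing-element Y Y≢⊤ with any? (λ v → ¬? (v ∈? Y))
... | yes found = found
... | no none   = ⊥-elim (Y≢⊤ (⊆-antisym ⊆⊤ (λ {v} _ → member v)))
  where
  member : ∀ v → v ∈ Y
  member v with v ∈? Y
  ... | yes v∈Y = v∈Y
  ... | no  v∉Y = ⊥-elim (none (v , v∉Y))

module _ {n : ℕ} (H : Graph n) where

  ∈nbr⇒adj : ∀ v u → u ∈ nbr H v → adj H v u ≡ true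
  ∈nbr⇒adj v u u∈N = trans (≡-sym (lookup∘tabulate (adj H v) u)) ([]=⇒lookup u∈N)

  deg≤degMinus : ∀ Y v → ¬ AdjToSet H v Y → deg H v ≤ degMinus H Y v
  deg≤degMinus Y v noNbr = p⊆q⇒∣p∣≤∣q∣ nbr⊆nbr-Y
    where
    nbr⊆nbr-Y : nbr H v ⊆ nbr H v ∩ ∁ Y
    nbr⊆nbr-Y {u} u∈N =
      x∈p∩q⁺ (u∈N , x∉p⇒x∈∁p (λ u∈Y → noNbr (u , u∈Y , ∈nbr⇒adj v u u∈N)))

  high-degree-off-w : ∀ k w → LowSetIs H (suc k) w →
                      ∀ (Y : Subset n) → w ∈ Y → ∀ v → v ∉ Y → suc k ≤ deg H v
  high-degree-off-w k w low Y w∈Y v v∉Y with deg H v ≤? k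
  ... | yes low-v = ⊥-elim (v∉Y (subst (_∈ Y) (≡-sym (proj₁ (low v) low-v)) w∈Y))
  ... | no  high  = ≰⇒> high

  outside-shadow-high : ∀ k (C : List (Subset n)) w → LowSetIs H (suc k) w →
                        ∀ Y → ShadowConditions H (suc k) C w Y →
                        ∀ v → v ∉ Y → suc k ≤ degMinus H Y v
  outside-shadow-high k C w low Y (w∈Y , _ , closed , _) v v∉Y
    with any? (λ u → (u ∈? Y) ×-dec (adj H v u ≟ᵇ true))
  ... | yes adjacent = closed v v∉Y adjacent
  ... | no  isolated =
    ≤-trans (high-degree-off-w k w low Y w∈Y v v∉Y) (deg≤degMinus Y v isolated)

corollary4p14 : (k : ℕ) → 2 ≤ k → {n : ℕ} (H : Graph n) (C : List (Subset n)) →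
    GoodCollection H k C → (w : Fin n) → LowSetIs H k w →
    (Y : Subset n) → IsShadow H k C w Y → ¬ (Y ≡ ⊤) →
    (∃ λ v → v ∉ Y) × (∀ v → v ∉ Y → k ≤ degMinus H Y v)
corollary4p14 (suc k) _ H C _ w low Y (shadow , _) Y≢⊤ =
  missing-element Y Y≢⊤ , outside-shadow-high H k C w low Y shadow
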